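{- Let $\mathcal{C} = \{C_1,\dots,C_k\}$ be a partition of an $n$-element set $V$ into $k$ nonempty clusters with $|C_a| = n_a$, and let $\alpha_{\mathcal{C}}$ be an error-free same-cluster oracle for $\mathcal{C}$. Let $Q_{\mathcal{C}}$ and $Q^k_{\mathcal{C}}$ be the (random) numbers of queries made by Randomized\_RS and Randomized\_RS\_k respectively. Then $$ \mathbb{E}[Q_{\mathcal{C}}] = (n-k) + \sum_{\substack{a,b\in[k]\\ a\ne b}} \frac{n_a n_b}{n_a+n_b}, $$ where the sum is over ordered pairs $(a,b)$, and $$ \mathbb{E}[Q^k_{\mathcal{C}}] \le \mathbb{E}[Q_{\mathcal{C}}] \le \frac{n(k+1)}{2} - k. $$
   Context: The same-cluster oracle answers, for distinct $u,v\in V$, whether $u,v$ lie in the same cluster. Randomized\_RS: maintain a list of discovered clusters (initially empty) in order of creation; repeatedly pick an unprocessed element $v$ uniformly at random among the unprocessed ones (i.e. process elements in a uniformly random order); for each discovered cluster in order of creation, query $v$ against one element of that cluster, and if the answer is "same cluster", add $v$ to it and stop; if no match is found, create a new cluster $\{v\}$. Randomized\_RS\_k (with $k$ known): identical, except that $v$ is compared only against the first $\min\{\text{number of discovered clusters}, k-1\}$ clusters; if no match is found, a new cluster $\{v\}$ is created if fewer than $k$ clusters have been discovered, and otherwise $v$ is added to the $k$-th cluster without further queries. -}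

module Defs where

open import Data.Nat using (ℕ; zero; suc; _+_; _*_; _∸_; _<ᵇ_)
open import Data.Bool using (Bool; true; false; if_then_else_)
open import Data.List using (List; []; _∷_; _++_; [_]; length; take; map; concatMap; foldr)
open import Data.Fin using (Fin)
open import Data.Product using (_×_; _,_)
open import Data.Integer using (+_)
open import Data.Rational using (ℚ; 0ℚ; _/_) renaming (_+_ to _+ℚ_)

-- ℕ-valued fraction p/q as a rational; convention: value 0 when q = 0
-- (only ever applied to positive denominators in the statement).
_/ℕ_ : ℕ → ℕ → ℚ
p /ℕ zero = 0ℚ
p /ℕ suc q = (+ p) / suc q

sumℚ : List ℚ → ℚ
sumℚ = foldr _+ℚ_ 0ℚ

sumℕ : List ℕ → ℕ
sumℕ = foldr _+_ 0

insertAll : {A : Set} → A → List A → List (List A)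
insertAll x [] = (x ∷ []) ∷ []
insertAll x (y ∷ ys) = (x ∷ y ∷ ys) ∷ map (y ∷_) (insertAll x ys)

perms : {A : Set} → List A → List (List A)
perms [] = [] ∷ []
perms (x ∷ xs) = concatMap (insertAll x) (perms xs)

average : {A : Set} → (A → ℕ) → List A → ℚ
average f xs = sumℕ (map f xs) /ℕ length xs

-- Clusters are represented by the list of their first elements (representatives),
-- in order of creation; querying "one element of that cluster" = querying its representative.

scan : {V : Set} → (V → V → Bool) → V → List V → ℕ × Bool
scan α v [] = 0 , false
scan α v (r ∷ rs) with α v r
... | true = 1 , true
... | false with scan α v rs
...   | q , b = suc q , b

rsQueries : {V : Set} → (V → V → Bool) → List V → List V → ℕ
rsQueries α reps [] = 0
rsQueries α reps (v ∷ vs) with scan α v reps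
... | q , true  = q + rsQueries α reps vs
... | q , false = q + rsQueries α (reps ++ [ v ]) vs

rsKQueries : {V : Set} → ℕ → (V → V → Bool) → List V → List V → ℕ
rsKQueries k α reps [] = 0
rsKQueries k α reps (v ∷ vs) with scan α v (take (k ∸ 1) reps)
... | q , true  = q + rsKQueries k α reps vs
... | q , false =
  q + rsKQueries k α (if length reps <ᵇ k then reps ++ [ v ] else reps) vs

-- Q_C and Q^k_C for V = Fin n, each processing order drawn uniformly at random
EQ : (n : ℕ) → (Fin n → Fin n → Bool) → List (Fin n) → ℚ
EQ n α V = average (rsQueries α []) (perms V)

EQk : (n k : ℕ) → (Fin n → Fin n → Bool) → List (Fin n) → ℚ
EQk n k α V = average (rsKQueries k α []) (perms V)

open import Data.Fin.Properties using (_≟_)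
open import Relation.Nullary using (¬?)
open import Data.List using (allFin; filter)

sumDistinctPairs : (k : ℕ) → (Fin k → Fin k → ℚ) → ℚ
sumDistinctPairs k f =
  sumℚ (concatMap (λ a → map (f a) (filter (λ b → ¬? (a ≟ b)) (allFin k))) (allFin k))

clusterSize : {n k : ℕ} → (Fin n → Fin k) → Fin k → ℕ
clusterSize {n} c a = length (filter (λ v → c v ≟ a) (allFin n))

-- Label every element by its cluster. When Randomized_RS processes v, the representatives it
-- holds are those of the clusters first seen before v, in order of discovery: if the cluster of v
-- is among them, v is compared with every cluster first seen before its own and then with its own;
-- otherwise with all of them, and v opens a new cluster. Hence on the order π
--   Q(π) + k = n + Σ_v #{clusters whose first element precedes the first element of the cluster of v}.
-- Cluster b is first seen before cluster a iff the first element of C_a ∪ C_b lies in C_b, which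
-- happens in a fraction n_b/(n_a + n_b) of all orders; summing gives E[Q]. The bound follows from
-- n_a n_b/(n_a + n_b) ≤ (n_a + n_b)/4. Randomized_RS_k makes the same queries as Randomized_RS
-- while fewer than k clusters are known; afterwards every element belongs to a known cluster and
-- its scan of the first k - 1 clusters is a prefix of the scan of all of them.

module Submission where

open import Data.Bool as Bool using (Bool; true; false)
open import Data.Empty using (⊥-elim)
open import Data.Fin using (Fin; zero; suc)
open import Data.Fin.Properties using (_≟_; suc-injective)
import Data.Integer as ℤ
import Data.Integer.Properties as ℤ
open import Data.Integer.Tactic.RingSolver using () renaming (solve-∀ to ℤ-solve-∀)
open import Data.List using (List; []; _∷_; _++_; [_]; length; map; take; concatMap; filter; allFin)
import Data.List.Properties as List
open import Data.List.Membership.Propositional using (_∈_)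
import Data.List.Membership.Propositional.Properties as ∈
open import Data.List.Relation.Binary.Permutation.Propositional
  using (_↭_; ↭-refl; ↭-prep; ↭-swap; ↭-trans; ↭-sym; ↭⇒↭ₛ)
import Data.List.Relation.Binary.Permutation.Propositional.Properties as ↭
import Data.List.Relation.Binary.Permutation.Setoid.Properties as PermutationSetoid
open import Data.List.Relation.Unary.All as All using (All; []; _∷_)
import Data.List.Relation.Unary.All.Properties as All
import Data.List.Relation.Unary.AllPairs.Properties as AllPairs
open import Data.List.Relation.Unary.Any using (here; there)
open import Data.List.Relation.Unary.Unique.Propositional using (Unique; []; _∷_)
import Data.List.Relation.Unary.Unique.Propositional.Properties as Unique
open import Data.Nat using (ℕ; zero; suc; _+_; _*_; _∸_; _≤_; _<_; _<ᵇ_; _!; z≤n; s≤s)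
open import Data.Nat.ListAction.Properties using (sum-↭; sum-++)
import Data.Nat.Properties as ℕ
open import Algebra.Properties.CommutativeSemigroup ℕ.+-commutativeSemigroup using (interchange)
open import Data.Nat.Tactic.RingSolver using (solve-∀)
open import Data.Product using (∃; _×_; _,_; proj₁; map₂)
open import Data.Rational using (ℚ; toℚᵘ; 0ℚ; -_; _-_) renaming (_+_ to _+ℚ_; _≤_ to _≤ℚ_)
import Data.Rational.Properties as ℚ
open import Data.Rational.Unnormalised as ℚᵘ using (mkℚᵘ; *≡*; *≤*; _≃_)
import Data.Rational.Unnormalised.Properties as ℚᵘ
open import Data.Sum using (inj₁; inj₂)
open import Function using (_∘_; _⇔_; Equivalence)
open import Relation.Nullary using (¬_; ¬?; Dec; yes; no; does)
open import Relation.Binary.PropositionalEquality hiding ([_])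

open import Defs

∑ : {A : Set} → (A → ℕ) → List A → ℕ
∑ f xs = sumℕ (map f xs)

module _ {A : Set} where

  ∑-++ : ∀ (f : A → ℕ) xs ys → ∑ f (xs ++ ys) ≡ ∑ f xs + ∑ f ys
  ∑-++ f xs ys = trans (cong sumℕ (List.map-++ f xs ys)) (sum-++ (map f xs) (map f ys))

  ∑-cong : ∀ {f g : A → ℕ} → (∀ x → f x ≡ g x) → ∀ xs → ∑ f xs ≡ ∑ g xs
  ∑-cong f≗g xs = cong sumℕ (List.map-cong f≗g xs)

  ∑-cong-on : ∀ {f g : A → ℕ} {xs} → All (λ x → f x ≡ g x) xs → ∑ f xs ≡ ∑ g xs
  ∑-cong-on [] = refl
  ∑-cong-on (e ∷ es) = cong₂ _+_ e (∑-cong-on es)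

  ∑-mono-on : ∀ {f g : A → ℕ} {xs} → All (λ x → f x ≤ g x) xs → ∑ f xs ≤ ∑ g xs
  ∑-mono-on [] = z≤n
  ∑-mono-on (e ∷ es) = ℕ.+-mono-≤ e (∑-mono-on es)

  ∑-mono : ∀ {f g : A → ℕ} → (∀ x → f x ≤ g x) → ∀ xs → ∑ f xs ≤ ∑ g xs
  ∑-mono f≤g xs = ∑-mono-on {xs = xs} (All.tabulate (λ {x} _ → f≤g x))

  ∑-+ : ∀ (f g : A → ℕ) xs → ∑ (λ x → f x + g x) xs ≡ ∑ f xs + ∑ g xs
  ∑-+ f g [] = refl
  ∑-+ f g (x ∷ xs) rewrite ∑-+ f g xs = interchange (f x) (g x) (∑ f xs) (∑ g xs)

  ∑-*ˡ : ∀ a (f : A → ℕ) xs → ∑ (λ x → a * f x) xs ≡ a * ∑ f xs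
  ∑-*ˡ a f [] = sym (ℕ.*-zeroʳ a)
  ∑-*ˡ a f (x ∷ xs) rewrite ∑-*ˡ a f xs = sym (ℕ.*-distribˡ-+ a (f x) (∑ f xs))

  ∑-*ʳ : ∀ a (f : A → ℕ) xs → ∑ (λ x → f x * a) xs ≡ ∑ f xs * a
  ∑-*ʳ a f xs = trans (∑-cong (λ x → ℕ.*-comm (f x) a) xs) (trans (∑-*ˡ a f xs) (ℕ.*-comm a _))

  ∑-const : ∀ a (xs : List A) → ∑ (λ _ → a) xs ≡ length xs * a
  ∑-const a [] = refl
  ∑-const a (x ∷ xs) = cong (a +_) (∑-const a xs)

  ∑-zero : ∀ (xs : List A) → ∑ (λ _ → 0) xs ≡ 0
  ∑-zero xs = trans (∑-const 0 xs) (ℕ.*-zeroʳ (length xs))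

  ∑-length : ∀ (xs : List A) → ∑ (λ _ → 1) xs ≡ length xs
  ∑-length xs = trans (∑-const 1 xs) (ℕ.*-identityʳ (length xs))

  ∑-↭ : ∀ (f : A → ℕ) {xs ys} → xs ↭ ys → ∑ f xs ≡ ∑ f ys
  ∑-↭ f p = sum-↭ (↭.map⁺ f p)

module _ {A B : Set} where

  ∑-map : ∀ (f : B → ℕ) (g : A → B) xs → ∑ f (map g xs) ≡ ∑ (f ∘ g) xs
  ∑-map f g xs = cong sumℕ (sym (List.map-∘ xs))

  ∑-concatMap : ∀ (f : B → ℕ) (h : A → List B) xs → ∑ f (concatMap h xs) ≡ ∑ (∑ f ∘ h) xs
  ∑-concatMap f h [] = refl
  ∑-concatMap f h (x ∷ xs) = trans (∑-++ f (h x) (concatMap h xs)) (cong (∑ f (h x) +_) (∑-concatMap f h xs))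

  ∑-comm : ∀ (h : A → B → ℕ) xs ys → ∑ (λ x → ∑ (h x) ys) xs ≡ ∑ (λ y → ∑ (λ x → h x y) xs) ys
  ∑-comm h [] ys = sym (∑-zero ys)
  ∑-comm h (x ∷ xs) ys = trans (cong (∑ (h x) ys +_) (∑-comm h xs ys)) (sym (∑-+ (h x) (λ y → ∑ (λ x → h x y) xs) ys))

∑-allFin-suc : ∀ {k} (f : Fin (suc k) → ℕ) → ∑ f (allFin (suc k)) ≡ f zero + ∑ (f ∘ suc) (allFin k)
∑-allFin-suc {k} f = cong (λ xs → f zero + sumℕ xs)
  (trans (List.map-tabulate {n = k} suc f) (sym (List.map-tabulate (λ x → x) (f ∘ suc))))

-- Enumerating permutations

module _ {A : Set} where

  ∑perms : (List A → ℕ) → List A → ℕ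
  ∑perms f xs = ∑ f (perms xs)

  picks : List A → List (A × List A)
  picks [] = []
  picks (y ∷ ys) = (y , ys) ∷ map (map₂ (y ∷_)) (picks ys)

  ∑perms-cong : ∀ {f g : List A → ℕ} → (∀ π → f π ≡ g π) → ∀ xs → ∑perms f xs ≡ ∑perms g xs
  ∑perms-cong f≗g xs = ∑-cong f≗g (perms xs)

  ∑perms-∷ : ∀ (f : List A → ℕ) y xs → ∑perms f (y ∷ xs) ≡ ∑perms (∑ f ∘ insertAll y) xs
  ∑perms-∷ f y xs = ∑-concatMap f (insertAll y) (perms xs)

  ∑perms-insertAll-∷ : ∀ (f : List A → ℕ) y x r →
    ∑perms (λ π → ∑ f (insertAll y (x ∷ π))) r
      ≡ ∑perms (λ π → f (y ∷ x ∷ π)) r + ∑perms (λ π → f (x ∷ π)) (y ∷ r)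
  ∑perms-insertAll-∷ f y x r = begin
      ∑perms (λ π → ∑ f (insertAll y (x ∷ π))) r
    ≡⟨ ∑perms-cong (λ π → cong (f (y ∷ x ∷ π) +_) (∑-map f (x ∷_) (insertAll y π))) r ⟩
      ∑perms (λ π → f (y ∷ x ∷ π) + ∑ (λ π → f (x ∷ π)) (insertAll y π)) r
    ≡⟨ ∑-+ (λ π → f (y ∷ x ∷ π)) (λ π → ∑ (λ π → f (x ∷ π)) (insertAll y π)) (perms r) ⟩
      ∑perms (λ π → f (y ∷ x ∷ π)) r + ∑perms (λ π → ∑ (λ π → f (x ∷ π)) (insertAll y π)) r
    ≡⟨ cong (∑perms (λ π → f (y ∷ x ∷ π)) r +_) (∑perms-∷ (λ π → f (x ∷ π)) y r) ⟨
      ∑perms (λ π → f (y ∷ x ∷ π)) r + ∑perms (λ π → f (x ∷ π)) (y ∷ r)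
    ∎
    where open ≡-Reasoning

  ∑perms-split : ∀ (f : List A → ℕ) y ys →
    ∑perms f (y ∷ ys) ≡ ∑perms (f ∘ (y ∷_)) ys + ∑ (λ (x , r) → ∑perms (f ∘ (x ∷_)) (y ∷ r)) (picks ys)
  ∑perms-split f y [] = sym (ℕ.+-identityʳ _)
  ∑perms-split f y (z ∷ zs) = begin
      ∑perms f (y ∷ z ∷ zs)
    ≡⟨ ∑perms-∷ f y (z ∷ zs) ⟩
      ∑perms g (z ∷ zs)
    ≡⟨ ∑perms-split g z zs ⟩
      ∑perms (g ∘ (z ∷_)) zs + ∑ (λ (x , r) → ∑perms (g ∘ (x ∷_)) (z ∷ r)) (picks zs)
    ≡⟨ cong₂ _+_ (∑perms-insertAll-∷ f y z zs)
         (trans (∑-cong (λ (x , r) → ∑perms-insertAll-∷ f y x (z ∷ r)) (picks zs)) (∑-+ _ _ (picks zs))) ⟩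
      (a + b) + (c + d)
    ≡⟨ interchange a b c d ⟩
      (a + c) + (b + d)
    ≡⟨ cong₂ _+_ (∑perms-split (f ∘ (y ∷_)) z zs)
         (cong (b +_) (∑-map (λ (x , r) → ∑perms (f ∘ (x ∷_)) (y ∷ r)) (map₂ (z ∷_)) (picks zs))) ⟨
      ∑perms (f ∘ (y ∷_)) (z ∷ zs) + ∑ (λ (x , r) → ∑perms (f ∘ (x ∷_)) (y ∷ r)) (picks (z ∷ zs))
    ∎
    where
    open ≡-Reasoning
    g : List A → ℕ
    g = ∑ f ∘ insertAll y
    a b c d : ℕ
    a = ∑perms (f ∘ (y ∷_) ∘ (z ∷_)) zs
    b = ∑perms (f ∘ (z ∷_)) (y ∷ zs)
    c = ∑ (λ (x , r) → ∑perms (f ∘ (y ∷_) ∘ (x ∷_)) (z ∷ r)) (picks zs)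
    d = ∑ (λ (x , r) → ∑perms (f ∘ (x ∷_)) (y ∷ z ∷ r)) (picks zs)

  ∑perms-picks : ∀ (f : List A → ℕ) y ys →
    ∑perms f (y ∷ ys) ≡ ∑ (λ (x , r) → ∑perms (f ∘ (x ∷_)) r) (picks (y ∷ ys))
  ∑perms-picks f y ys = trans (∑perms-split f y ys)
    (cong (∑perms (f ∘ (y ∷_)) ys +_) (sym (∑-map (λ (x , r) → ∑perms (f ∘ (x ∷_)) r) (map₂ (y ∷_)) (picks ys))))

  picks-↭ : ∀ (xs : List A) → All (λ (x , r) → x ∷ r ↭ xs) (picks xs)
  picks-↭ [] = []
  picks-↭ (y ∷ ys) = ↭-refl ∷ All.map⁺ (All.map (λ p → ↭-trans (↭-swap _ y ↭-refl) (↭-prep y p)) (picks-↭ ys))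

  map-proj₁-picks : ∀ (xs : List A) → map proj₁ (picks xs) ≡ xs
  map-proj₁-picks [] = refl
  map-proj₁-picks (y ∷ ys) = cong (y ∷_) (trans (sym (List.map-∘ (picks ys))) (map-proj₁-picks ys))

  ∑-picks : ∀ (h : A → ℕ) xs → ∑ (h ∘ proj₁) (picks xs) ≡ ∑ h xs
  ∑-picks h xs = trans (sym (∑-map h proj₁ (picks xs))) (cong (∑ h) (map-proj₁-picks xs))

  insertAll-↭ : ∀ (x : A) π → All (_↭ x ∷ π) (insertAll x π)
  insertAll-↭ x [] = ↭-refl ∷ []
  insertAll-↭ x (y ∷ ys) =
    ↭-refl ∷ All.map⁺ (All.map (λ p → ↭-trans (↭-prep y p) (↭-swap y x ↭-refl)) (insertAll-↭ x ys))

  perms-↭ : ∀ (xs : List A) → All (_↭ xs) (perms xs)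
  perms-↭ [] = ↭-refl ∷ []
  perms-↭ (x ∷ xs) = All.concat⁺ (All.map⁺ (All.map
    (λ π↭xs → All.map (λ ρ↭xπ → ↭-trans ρ↭xπ (↭-prep x π↭xs)) (insertAll-↭ x _)) (perms-↭ xs)))

  length-insertAll : ∀ (x : A) π → length (insertAll x π) ≡ suc (length π)
  length-insertAll x [] = refl
  length-insertAll x (y ∷ ys) = cong suc (trans (List.length-map (y ∷_) (insertAll x ys)) (length-insertAll x ys))

  length-perms : ∀ (xs : List A) → length (perms xs) ≡ length xs !
  length-perms [] = refl
  length-perms (x ∷ xs) = begin
      length (perms (x ∷ xs))                     ≡⟨ ∑-length (perms (x ∷ xs)) ⟨
      ∑perms one (x ∷ xs)                         ≡⟨ ∑perms-∷ one x xs ⟩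
      ∑perms (∑ one ∘ insertAll x) xs             ≡⟨ ∑-cong-on {xs = perms xs} (All.map (λ {π} → length-π π) (perms-↭ xs)) ⟩
      ∑perms (λ _ → suc (length xs)) xs           ≡⟨ ∑-const (suc (length xs)) (perms xs) ⟩
      length (perms xs) * suc (length xs)         ≡⟨ cong (_* suc (length xs)) (length-perms xs) ⟩
      length xs ! * suc (length xs)               ≡⟨ ℕ.*-comm (length xs !) _ ⟩
      suc (length xs) * length xs !               ∎
    where
    open ≡-Reasoning
    one : List A → ℕ
    one _ = 1
    length-π : ∀ π → π ↭ xs → ∑ one (insertAll x π) ≡ suc (length xs)
    length-π π π↭xs = trans (∑-length (insertAll x π)) (trans (length-insertAll x π) (cong suc (↭.↭-length π↭xs)))

-- Which of two roles comes first

data Role : Set where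
  target rival bystander : Role

lead : Role → ℕ → ℕ
lead target    _ = 0
lead rival     _ = 1
lead bystander r = r

isTarget isRival isBystander : Role → ℕ
isTarget target = 1
isTarget _      = 0
isRival rival = 1
isRival _     = 0
isBystander bystander = 1
isBystander _         = 0

roles-partition : ∀ ρ → isTarget ρ + isRival ρ + isBystander ρ ≡ 1
roles-partition target    = refl
roles-partition rival     = refl
roles-partition bystander = refl

module _ {A : Set} (κ : A → Role) where

  rivalLeads : List A → ℕ
  rivalLeads []       = 0
  rivalLeads (x ∷ xs) = lead (κ x) (rivalLeads xs)

  #target #rival #bystander : List A → ℕ
  #target    = ∑ (isTarget ∘ κ)
  #rival     = ∑ (isRival ∘ κ)
  #bystander = ∑ (isBystander ∘ κ)

  #roles : ∀ xs → #target xs + #rival xs + #bystander xs ≡ length xs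
  #roles xs = begin
      #target xs + #rival xs + #bystander xs
    ≡⟨ cong (_+ #bystander xs) (∑-+ (isTarget ∘ κ) (isRival ∘ κ) xs) ⟨
      ∑ (λ x → isTarget (κ x) + isRival (κ x)) xs + #bystander xs
    ≡⟨ ∑-+ (λ x → isTarget (κ x) + isRival (κ x)) (isBystander ∘ κ) xs ⟨
      ∑ (λ x → isTarget (κ x) + isRival (κ x) + isBystander (κ x)) xs
    ≡⟨ ∑-cong (roles-partition ∘ κ) xs ⟩
      ∑ (λ _ → 1) xs
    ≡⟨ ∑-length xs ⟩
      length xs
    ∎
    where open ≡-Reasoning

  ∑perms-rivalLeads-∷ : ∀ m x r → length r ≡ m →
    ∑perms rivalLeads r * (#target r + #rival r) ≡ m ! * #rival r →
    ∑perms (rivalLeads ∘ (x ∷_)) r * (#target (x ∷ r) + #rival (x ∷ r))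
      ≡ m ! * (isRival (κ x) * (#target (x ∷ r) + #rival (x ∷ r)) + isBystander (κ x) * #rival (x ∷ r))
  ∑perms-rivalLeads-∷ m x r |r| ih with κ x
  ... | target = trans (cong (_* suc (#target r + #rival r)) (∑-zero (perms r))) (sym (ℕ.*-zeroʳ (m !)))
  ... | rival = begin
      ∑perms (λ _ → 1) r * (T + R)   ≡⟨ cong (_* (T + R)) (trans (∑-length (perms r)) (length-perms r)) ⟩
      length r ! * (T + R)           ≡⟨ cong (λ l → l ! * (T + R)) |r| ⟩
      m ! * (T + R)                  ≡⟨ cong (m ! *_) (trans (ℕ.+-identityʳ _) (ℕ.+-identityʳ _)) ⟨
      m ! * (T + R + 0 + 0)          ∎
    where
    open ≡-Reasoning
    T R : ℕ
    T = #target r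
    R = suc (#rival r)
  ... | bystander = trans ih (cong (m ! *_) (sym (ℕ.+-identityʳ (#rival r))))

  -- Cross-multiplied, the first non-bystander of a uniformly random order of xs is a rival with
  -- probability #rival xs / (#target xs + #rival xs).
  ∑perms-rivalLeads : ∀ m xs → length xs ≡ m →
    ∑perms rivalLeads xs * (#target xs + #rival xs) ≡ m ! * #rival xs
  ∑perms-rivalLeads zero    []       _ = refl
  ∑perms-rivalLeads (suc m) (y ∷ ys) |xs| = begin
      ∑perms rivalLeads xs * (T + R)
    ≡⟨ cong (_* (T + R)) (∑perms-picks rivalLeads y ys) ⟩
      ∑ (λ (x , r) → ∑perms (rivalLeads ∘ (x ∷_)) r) (picks xs) * (T + R)
    ≡⟨ ∑-*ʳ (T + R) (λ (x , r) → ∑perms (rivalLeads ∘ (x ∷_)) r) (picks xs) ⟨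
      ∑ (λ (x , r) → ∑perms (rivalLeads ∘ (x ∷_)) r * (T + R)) (picks xs)
    ≡⟨ ∑-cong-on (All.map (λ {(x , r)} → first x r) (picks-↭ xs)) ⟩
      ∑ (weight ∘ proj₁) (picks xs)
    ≡⟨ ∑-picks weight xs ⟩
      ∑ weight xs
    ≡⟨ ∑-*ˡ (m !) (λ x → isRival (κ x) * (T + R) + isBystander (κ x) * R) xs ⟩
      m ! * ∑ (λ x → isRival (κ x) * (T + R) + isBystander (κ x) * R) xs
    ≡⟨ cong (m ! *_) (trans (∑-+ (λ x → isRival (κ x) * (T + R)) (λ x → isBystander (κ x) * R) xs)
                            (cong₂ _+_ (∑-*ʳ (T + R) (isRival ∘ κ) xs) (∑-*ʳ R (isBystander ∘ κ) xs))) ⟩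
      m ! * (R * (T + R) + B * R)
    ≡⟨ regroup (m !) T R B ⟩
      (T + R + B) * m ! * R
    ≡⟨ cong (λ l → l * m ! * R) (trans (#roles xs) |xs|) ⟩
      suc m * m ! * R
    ∎
    where
    open ≡-Reasoning
    xs = y ∷ ys
    T R B : ℕ
    T = #target xs
    R = #rival xs
    B = #bystander xs
    regroup : ∀ f t r b → f * (r * (t + r) + b * r) ≡ (t + r + b) * f * r
    regroup = solve-∀
    weight : A → ℕ
    weight x = m ! * (isRival (κ x) * (T + R) + isBystander (κ x) * R)
    first : ∀ x r → x ∷ r ↭ xs → ∑perms (rivalLeads ∘ (x ∷_)) r * (T + R) ≡ weight x
    first x r x∷r↭xs =
      subst₂ (λ t ρ → ∑perms (rivalLeads ∘ (x ∷_)) r * (t + ρ) ≡ m ! * (isRival (κ x) * (t + ρ) + isBystander (κ x) * ρ))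
      (∑-↭ (isTarget ∘ κ) x∷r↭xs) (∑-↭ (isRival ∘ κ) x∷r↭xs)
      (∑perms-rivalLeads-∷ m x r |r| (∑perms-rivalLeads m r |r|))
      where
      |r| : length r ≡ m
      |r| = ℕ.suc-injective (trans (↭.↭-length x∷r↭xs) |xs|)

rivalLeads-map : ∀ {A B : Set} (κ : B → Role) (f : A → B) xs → rivalLeads κ (map f xs) ≡ rivalLeads (κ ∘ f) xs
rivalLeads-map κ f []       = refl
rivalLeads-map κ f (x ∷ xs) = cong (lead (κ (f x))) (rivalLeads-map κ f xs)

δ : ∀ {k} → Fin k → Fin k → ℕ
δ x a with x ≟ a
... | yes _ = 1
... | no  _ = 0

module _ {k : ℕ} where

  δ-refl : ∀ (x : Fin k) → δ x x ≡ 1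
  δ-refl x with x ≟ x
  ... | yes _   = refl
  ... | no  x≢x = ⊥-elim (x≢x refl)

  δ-≢ : ∀ {x a : Fin k} → x ≢ a → δ x a ≡ 0
  δ-≢ {x} {a} x≢a with x ≟ a
  ... | yes x≡a = ⊥-elim (x≢a x≡a)
  ... | no  _   = refl

  δ-sym : ∀ (x a : Fin k) → δ x a ≡ δ a x
  δ-sym x a with x ≟ a
  ... | yes refl = sym (δ-refl x)
  ... | no  x≢a  = sym (δ-≢ (x≢a ∘ sym))

δ-suc : ∀ {k} (x a : Fin k) → δ (suc x) (suc a) ≡ δ x a
δ-suc x a = byCases (x ≟ a)
  where
  byCases : Dec (x ≡ a) → δ (suc x) (suc a) ≡ δ x a
  byCases (yes refl) = trans (δ-refl (suc x)) (sym (δ-refl x))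
  byCases (no x≢a)   = trans (δ-≢ (x≢a ∘ suc-injective)) (sym (δ-≢ x≢a))

∑-δ : ∀ {k} (x : Fin k) (h : Fin k → ℕ) → ∑ (λ a → δ x a * h a) (allFin k) ≡ h x
∑-δ {suc k} zero h = begin
    ∑ (λ a → δ zero a * h a) (allFin (suc k))     ≡⟨ ∑-allFin-suc (λ a → δ zero a * h a) ⟩
    h zero + 0 + ∑ (λ _ → 0) (allFin k)          ≡⟨ cong₂ _+_ (ℕ.+-identityʳ (h zero)) (∑-zero (allFin k)) ⟩
    h zero + 0                                    ≡⟨ ℕ.+-identityʳ (h zero) ⟩
    h zero                                        ∎
  where open ≡-Reasoning
∑-δ {suc k} (suc x) h = begin
    ∑ (λ a → δ (suc x) a * h a) (allFin (suc k))  ≡⟨ ∑-allFin-suc (λ a → δ (suc x) a * h a) ⟩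
    ∑ (λ a → δ (suc x) (suc a) * h (suc a)) (allFin k)
      ≡⟨ ∑-cong (λ a → cong (_* h (suc a)) (δ-suc x a)) (allFin k) ⟩
    ∑ (λ a → δ x a * h (suc a)) (allFin k)        ≡⟨ ∑-δ x (h ∘ suc) ⟩
    h (suc x)                                     ∎
  where open ≡-Reasoning

∑-δʳ : ∀ {k} (x : Fin k) → ∑ (δ x) (allFin k) ≡ 1
∑-δʳ {k} x = trans (∑-cong (λ a → sym (ℕ.*-identityʳ (δ x a))) (allFin k)) (∑-δ x (λ _ → 1))

occ : ∀ {k} → Fin k → List (Fin k) → ℕ
occ a = ∑ (λ x → δ x a)

module _ {k : ℕ} where

  occ-allFin : ∀ (a : Fin k) → occ a (allFin k) ≡ 1
  occ-allFin a = trans (∑-cong (λ x → δ-sym x a) (allFin k)) (∑-δʳ a)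

  ∑-byOcc : ∀ (g : Fin k → ℕ) xs → ∑ g xs ≡ ∑ (λ a → occ a xs * g a) (allFin k)
  ∑-byOcc g [] = sym (∑-zero (allFin k))
  ∑-byOcc g (x ∷ xs) = begin
      g x + ∑ g xs
    ≡⟨ cong₂ _+_ (sym (∑-δ x g)) (∑-byOcc g xs) ⟩
      ∑ (λ a → δ x a * g a) (allFin k) + ∑ (λ a → occ a xs * g a) (allFin k)
    ≡⟨ ∑-+ (λ a → δ x a * g a) (λ a → occ a xs * g a) (allFin k) ⟨
      ∑ (λ a → δ x a * g a + occ a xs * g a) (allFin k)
    ≡⟨ ∑-cong (λ a → ℕ.*-distribʳ-+ (g a) (δ x a) (occ a xs)) (allFin k) ⟨
      ∑ (λ a → occ a (x ∷ xs) * g a) (allFin k)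
    ∎
    where open ≡-Reasoning

  occ-absent : ∀ {x : Fin k} {xs} → All (x ≢_) xs → occ x xs ≡ 0
  occ-absent [] = refl
  occ-absent {x} (x≢y ∷ ps) = cong₂ _+_ (δ-≢ (x≢y ∘ sym)) (occ-absent ps)

  occ-present : ∀ {x : Fin k} {xs} → x ∈ xs → 1 ≤ occ x xs
  occ-present {x} (here refl) = ℕ.≤-trans (ℕ.≤-reflexive (sym (δ-refl x))) (ℕ.m≤m+n _ _)
  occ-present {x} {y ∷ _} (there p) = ℕ.≤-trans (occ-present p) (ℕ.m≤n+m _ (δ y x))

  occ-unique : ∀ {xs} → Unique xs → ∀ (a : Fin k) → occ a xs ≤ 1
  occ-unique [] a = z≤n
  occ-unique {x ∷ xs} (x∉xs ∷ xs!) a with x ≟ a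
  ... | yes refl = ℕ.≤-reflexive (cong suc (occ-absent x∉xs))
  ... | no  _    = occ-unique xs! a

length-allFin : ∀ n → length (allFin n) ≡ n
length-allFin n = List.length-tabulate (λ v → v)

length-filter-≟ : ∀ {A : Set} {k} (c : A → Fin k) a xs → length (filter (λ v → c v ≟ a) xs) ≡ ∑ (λ v → δ (c v) a) xs
length-filter-≟ c a [] = refl
length-filter-≟ c a (v ∷ xs) with c v ≟ a
... | yes _ = cong suc (length-filter-≟ c a xs)
... | no  _ = length-filter-≟ c a xs

module _ {k : ℕ} where
  open import Data.List.Membership.DecPropositional (_≟_ {k}) using (_∈?_)

  length-∑occ : ∀ (xs : List (Fin k)) → length xs ≡ ∑ (λ a → occ a xs) (allFin k)
  length-∑occ xs = trans (sym (∑-length xs))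
    (trans (∑-byOcc (λ _ → 1) xs) (∑-cong (λ a → ℕ.*-identityʳ (occ a xs)) (allFin k)))

  unique-complete-length : ∀ {xs} → Unique xs → (∀ a → a ∈ xs) → length xs ≡ k
  unique-complete-length {xs} xs! complete = begin
      length xs                          ≡⟨ length-∑occ xs ⟩
      ∑ (λ a → occ a xs) (allFin k)      ≡⟨ ∑-cong occ≡1 (allFin k) ⟩
      ∑ (λ _ → 1) (allFin k)             ≡⟨ ∑-length (allFin k) ⟩
      length (allFin k)                  ≡⟨ length-allFin k ⟩
      k                                  ∎
    where
    open ≡-Reasoning
    occ≡1 : ∀ a → occ a xs ≡ 1
    occ≡1 a = ℕ.≤-antisym (occ-unique xs! a) (occ-present (complete a))

  unique-long-complete : ∀ {xs} → Unique xs → k ≤ length xs → ∀ a → a ∈ xs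
  unique-long-complete {xs} xs! k≤|xs| a with a ∈? xs
  ... | yes a∈xs = a∈xs
  ... | no  a∉xs = ⊥-elim (ℕ.<-irrefl refl (ℕ.<-≤-trans |xs|<k k≤|xs|))
    where
    occ+δ≤1 : ∀ b → occ b xs + δ a b ≤ 1
    occ+δ≤1 b with a ≟ b
    ... | yes refl = ℕ.≤-reflexive (cong (_+ 1) (occ-absent (All.¬Any⇒All¬ xs a∉xs)))
    ... | no  _    = ℕ.≤-trans (ℕ.≤-reflexive (ℕ.+-identityʳ _)) (occ-unique xs! b)
    |xs|<k : length xs < k
    |xs|<k = begin-strict
      length xs                                        <⟨ ℕ.m<m+n (length xs) (s≤s z≤n) ⟩
      length xs + 1                                     ≡⟨ cong₂ _+_ (length-∑occ xs) (sym (∑-δʳ a)) ⟩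
      ∑ (λ b → occ b xs) (allFin k) + ∑ (δ a) (allFin k) ≡⟨ ∑-+ (λ b → occ b xs) (δ a) (allFin k) ⟨
      ∑ (λ b → occ b xs + δ a b) (allFin k)             ≤⟨ ∑-mono occ+δ≤1 (allFin k) ⟩
      ∑ (λ _ → 1) (allFin k)                            ≡⟨ trans (∑-length (allFin k)) (length-allFin k) ⟩
      k                                                 ∎
      where open ℕ.≤-Reasoning

-- First occurrences and ranks

module _ {k : ℕ} where

  role : Fin k → Fin k → Fin k → Role
  role a b x with x ≟ a
  ... | yes _ = target
  ... | no  _ with x ≟ b
  ...   | yes _ = rival
  ...   | no  _ = bystander

  -- firstBefore xs b a is 1 iff b ≢ a and the first occurrence of b in xs precedes every occurrence of a.
  firstBefore : List (Fin k) → Fin k → Fin k → ℕ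
  firstBefore xs b a = rivalLeads (role a b) xs

  rank : List (Fin k) → Fin k → ℕ
  rank xs a = ∑ (λ b → firstBefore xs b a) (allFin k)

  role-target : ∀ a b → role a b a ≡ target
  role-target a b with a ≟ a
  ... | yes _   = refl
  ... | no  a≢a = ⊥-elim (a≢a refl)

  role-rival : ∀ {a b} → b ≢ a → role a b b ≡ rival
  role-rival {a} {b} b≢a with b ≟ a
  ... | yes b≡a = ⊥-elim (b≢a b≡a)
  ... | no  _ with b ≟ b
  ...   | yes _   = refl
  ...   | no  b≢b = ⊥-elim (b≢b refl)

  role-bystander : ∀ {a b x} → x ≢ a → x ≢ b → role a b x ≡ bystander
  role-bystander {a} {b} {x} x≢a x≢b with x ≟ a
  ... | yes x≡a = ⊥-elim (x≢a x≡a)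
  ... | no  _ with x ≟ b
  ...   | yes x≡b = ⊥-elim (x≢b x≡b)
  ...   | no  _   = refl

  role-bystander⁻ : ∀ a b x → role a b x ≡ bystander → x ≢ a × x ≢ b
  role-bystander⁻ a b x _ with x ≟ a
  ... | no x≢a with x ≟ b
  ...   | no x≢b = x≢a , x≢b

  rank-head : ∀ x xs → rank (x ∷ xs) x ≡ 0
  rank-head x xs =
    trans (∑-cong (λ b → cong (λ ρ → lead ρ (firstBefore xs b x)) (role-target x b)) (allFin k)) (∑-zero (allFin k))

  firstBefore-bystander : ∀ ys {x} zs {a b} → x ≢ a → x ≢ b →
    firstBefore (ys ++ x ∷ zs) b a ≡ firstBefore (ys ++ zs) b a
  firstBefore-bystander []       zs x≢a x≢b rewrite role-bystander x≢a x≢b = refl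
  firstBefore-bystander (y ∷ ys) zs {a} {b} x≢a x≢b = cong (lead (role a b y)) (firstBefore-bystander ys zs x≢a x≢b)

  firstBefore-repeat : ∀ ys {x} zs a b → x ∈ ys →
    firstBefore (ys ++ x ∷ zs) b a ≡ firstBefore (ys ++ zs) b a
  firstBefore-repeat (y ∷ ys) zs a b (there x∈ys) = cong (lead (role a b y)) (firstBefore-repeat ys zs a b x∈ys)
  firstBefore-repeat (x ∷ ys) zs a b (here refl) with role a b x in ρ
  ... | target    = refl
  ... | rival     = refl
  ... | bystander = let x≢a , x≢b = role-bystander⁻ a b x ρ in firstBefore-bystander ys zs x≢a x≢b

  firstBefore-absent : ∀ {d} ys {x} zs → All (d ≢_) ys → firstBefore (ys ++ x ∷ zs) d x ≡ 0
  firstBefore-absent {d} [] {x} zs [] rewrite role-target x d = refl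
  firstBefore-absent {d} (y ∷ ys) {x} zs (d≢y ∷ d∉ys) = byCases (y ≟ x)
    where
    byCases : Dec (y ≡ x) → firstBefore (y ∷ ys ++ x ∷ zs) d x ≡ 0
    byCases (yes refl) rewrite role-target y d = refl
    byCases (no y≢x)   rewrite role-bystander y≢x (d≢y ∘ sym) = firstBefore-absent ys zs d∉ys

  firstBefore-present : ∀ {d} ys {x} zs → All (d ≢_) ys → x ∈ ys → firstBefore (ys ++ zs) d x ≡ 0
  firstBefore-present {d} (y ∷ ys) {x} zs (d≢y ∷ d∉ys) x∈ = byCases (y ≟ x) x∈
    where
    byCases : Dec (y ≡ x) → x ∈ y ∷ ys → firstBefore (y ∷ ys ++ zs) d x ≡ 0
    byCases (yes refl) _          rewrite role-target y d = refl
    byCases (no y≢x)   (here refl) = ⊥-elim (y≢x refl)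
    byCases (no y≢x)   (there x∈ys) rewrite role-bystander y≢x (d≢y ∘ sym) = firstBefore-present ys zs d∉ys x∈ys

  rank-∷ : ∀ {d x} zs → d ≢ x → firstBefore zs d x ≡ 0 → rank (d ∷ zs) x ≡ suc (rank zs x)
  rank-∷ {d} {x} zs d≢x d⊀x = begin
      rank (d ∷ zs) x                                         ≡⟨ ∑-cong step (allFin k) ⟩
      ∑ (λ b → δ d b + firstBefore zs b x) (allFin k)          ≡⟨ ∑-+ (δ d) (λ b → firstBefore zs b x) (allFin k) ⟩
      ∑ (δ d) (allFin k) + rank zs x                          ≡⟨ cong (_+ rank zs x) (∑-δʳ d) ⟩
      suc (rank zs x)                                         ∎
    where
    open ≡-Reasoning
    step : ∀ b → firstBefore (d ∷ zs) b x ≡ δ d b + firstBefore zs b x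
    step b = byCases (d ≟ b)
      where
      byCases : Dec (d ≡ b) → firstBefore (d ∷ zs) b x ≡ δ d b + firstBefore zs b x
      byCases (yes refl) rewrite role-rival d≢x | δ-refl d = cong suc (sym d⊀x)
      byCases (no d≢b)   rewrite role-bystander d≢x d≢b | δ-≢ d≢b = refl

  rank-absent : ∀ {ys} {x : Fin k} zs → Unique ys → All (x ≢_) ys → rank (ys ++ x ∷ zs) x ≡ length ys
  rank-absent {[]}     {x} zs _ _ = rank-head x zs
  rank-absent {d ∷ ys} {x} zs (d∉ys ∷ ys!) (x≢d ∷ x∉ys) = begin
      rank (d ∷ ys ++ x ∷ zs) x  ≡⟨ rank-∷ (ys ++ x ∷ zs) (x≢d ∘ sym) (firstBefore-absent ys zs d∉ys) ⟩
      suc (rank (ys ++ x ∷ zs) x) ≡⟨ cong suc (rank-absent zs ys! x∉ys) ⟩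
      suc (length ys)             ∎
    where open ≡-Reasoning

  firstBefore-self : ∀ xs (a : Fin k) → firstBefore xs a a ≡ 0
  firstBefore-self []       a = refl
  firstBefore-self (x ∷ xs) a = byCases (x ≟ a)
    where
    byCases : Dec (x ≡ a) → firstBefore (x ∷ xs) a a ≡ 0
    byCases (yes refl) rewrite role-target x x = refl
    byCases (no x≢a)   rewrite role-bystander x≢a x≢a = firstBefore-self xs a

  isTarget-role : ∀ (a b x : Fin k) → isTarget (role a b x) ≡ δ x a
  isTarget-role a b x with x ≟ a
  ... | yes _ = refl
  ... | no  _ with x ≟ b
  ...   | yes _ = refl
  ...   | no  _ = refl

  isRival-role : ∀ {a b : Fin k} → a ≢ b → ∀ x → isRival (role a b x) ≡ δ x b
  isRival-role {a} {b} a≢b x = byCases (x ≟ a) (x ≟ b)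
    where
    byCases : Dec (x ≡ a) → Dec (x ≡ b) → isRival (role a b x) ≡ δ x b
    byCases (yes refl) _          rewrite role-target x b | δ-≢ a≢b = refl
    byCases (no x≢a)   (yes refl) rewrite role-rival x≢a | δ-refl x = refl
    byCases (no x≢a)   (no x≢b)   rewrite role-bystander x≢a x≢b | δ-≢ x≢b = refl

-- Relabelling a run by clusters

scan-take-≤ : ∀ {V : Set} (α : V → V → Bool) x j ys → proj₁ (scan α x (take j ys)) ≤ proj₁ (scan α x ys)
scan-take-≤ α x zero    ys       = z≤n
scan-take-≤ α x (suc j) []       = z≤n
scan-take-≤ α x (suc j) (y ∷ ys) with α x y
... | true  = ℕ.≤-refl
... | false with scan α x (take j ys) | scan α x ys | scan-take-≤ α x j ys
...   | _ , _ | _ , _ | q≤q′ = s≤s q≤q′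

module _ {V L : Set} (c : V → L) (α : V → V → Bool) (β : L → L → Bool)
         (α≡β : ∀ u v → u ≢ v → α u v ≡ β (c u) (c v)) where

  scan-map : ∀ {v rs} → All (v ≢_) rs → scan α v rs ≡ scan β (c v) (map c rs)
  scan-map [] = refl
  scan-map {v} {r ∷ rs} (v≢r ∷ v∉rs) rewrite α≡β v r v≢r with β (c v) (c r)
  ... | true  = refl
  ... | false rewrite scan-map v∉rs = refl

  private
    disjoint-∷ʳ : ∀ {v : V} {rs π} → All (v ≢_) π →
      All (λ u → All (u ≢_) rs) π → All (λ u → All (u ≢_) (rs ++ [ v ])) π
    disjoint-∷ʳ v∉π π∉rs = All.zipWith (λ (v≢u , u∉rs) → All.++⁺ u∉rs ((v≢u ∘ sym) ∷ [])) (v∉π , π∉rs)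

  rsQueries-map : ∀ rs π → Unique π → All (λ v → All (v ≢_) rs) π →
    rsQueries α rs π ≡ rsQueries β (map c rs) (map c π)
  rsQueries-map rs []      _            _             = refl
  rsQueries-map rs (v ∷ π) (v∉π ∷ π!) (v∉rs ∷ π∉rs) rewrite scan-map v∉rs with scan β (c v) (map c rs)
  ... | q , true  = cong (q +_) (rsQueries-map rs π π! π∉rs)
  ... | q , false = cong (q +_) (trans (rsQueries-map (rs ++ [ v ]) π π! (disjoint-∷ʳ v∉π π∉rs))
                                       (cong (λ ds → rsQueries β ds (map c π)) (List.map-++ c rs [ v ])))

  rsKQueries-map : ∀ k rs π → Unique π → All (λ v → All (v ≢_) rs) π →
    rsKQueries k α rs π ≡ rsKQueries k β (map c rs) (map c π)
  rsKQueries-map k rs []      _            _             = refl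
  rsKQueries-map k rs (v ∷ π) (v∉π ∷ π!) (v∉rs ∷ π∉rs)
    rewrite scan-map (All.take⁺ (k ∸ 1) v∉rs) | List.take-map {f = c} (k ∸ 1) rs
    with scan β (c v) (map c (take (k ∸ 1) rs))
  ... | q , true  = cong (q +_) (rsKQueries-map k rs π π! π∉rs)
  ... | q , false rewrite List.length-map c rs with length rs <ᵇ k
  ...   | true  = cong (q +_) (trans (rsKQueries-map k (rs ++ [ v ]) π π! (disjoint-∷ʳ v∉π π∉rs))
                                     (cong (λ ds → rsKQueries k β ds (map c π)) (List.map-++ c rs [ v ])))
  ...   | false = cong (q +_) (rsKQueries-map k rs π π! π∉rs)

sameLabel : ∀ {k} → Fin k → Fin k → Bool
sameLabel a b = does (a ≟ b)

module _ {k : ℕ} where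

  scan-absent : ∀ {x : Fin k} {ys} → All (x ≢_) ys → scan sameLabel x ys ≡ (length ys , false)
  scan-absent [] = refl
  scan-absent {x} {y ∷ ys} (x≢y ∷ x∉ys) with x ≟ y
  ... | yes x≡y = ⊥-elim (x≢y x≡y)
  ... | no  _   rewrite scan-absent x∉ys = refl

  scan-present : ∀ {x : Fin k} {ys} → Unique ys → x ∈ ys → ∀ zs →
    scan sameLabel x ys ≡ (suc (rank (ys ++ zs) x) , true)
  scan-present {x} {d ∷ ys} (d∉ys ∷ ys!) x∈ zs with x ≟ d | x∈
  ... | yes refl | _          = cong (λ r → suc r , true) (sym (rank-head x (ys ++ zs)))
  ... | no  x≢d  | here refl  = ⊥-elim (x≢d refl)
  ... | no  x≢d  | there x∈ys rewrite scan-present ys! x∈ys zs =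
    cong (λ r → suc r , true) (sym (rank-∷ (ys ++ zs) (x≢d ∘ sym) (firstBefore-present ys zs d∉ys x∈ys)))

<⇒≤∸1 : ∀ {m n} → m < n → m ≤ n ∸ 1
<⇒≤∸1 (s≤s m≤n) = m≤n

module _ {k : ℕ} where
  open import Data.List.Membership.DecPropositional (_≟_ {k}) using (_∈?_)

  unique-∷ʳ : ∀ {x : Fin k} {ys} → Unique ys → All (x ≢_) ys → Unique (ys ++ [ x ])
  unique-∷ʳ ys! x∉ys = AllPairs.++⁺ ys! ([] ∷ []) (All.map (λ x≢y → (x≢y ∘ sym) ∷ []) x∉ys)

  -- The labels of the representatives held by Randomized_RS after processing w from ys.
  reps : List (Fin k) → List (Fin k) → List (Fin k)
  reps ys []      = ys
  reps ys (x ∷ w) with x ∈? ys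
  ... | yes _ = reps ys w
  ... | no  _ = reps (ys ++ [ x ]) w

  reps-unique : ∀ ys w → Unique ys → Unique (reps ys w)
  reps-unique ys []      ys! = ys!
  reps-unique ys (x ∷ w) ys! with x ∈? ys
  ... | yes _    = reps-unique ys w ys!
  ... | no  x∉ys = reps-unique (ys ++ [ x ]) w (unique-∷ʳ ys! (All.¬Any⇒All¬ ys x∉ys))

  reps-⊇ˡ : ∀ {a} ys w → a ∈ ys → a ∈ reps ys w
  reps-⊇ˡ ys []      a∈ys = a∈ys
  reps-⊇ˡ ys (x ∷ w) a∈ys with x ∈? ys
  ... | yes _ = reps-⊇ˡ ys w a∈ys
  ... | no  _ = reps-⊇ˡ (ys ++ [ x ]) w (∈.∈-++⁺ˡ a∈ys)

  reps-⊇ʳ : ∀ {a} ys w → a ∈ w → a ∈ reps ys w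
  reps-⊇ʳ ys (x ∷ w) a∈ with x ∈? ys | a∈
  ... | yes x∈ys | here refl = reps-⊇ˡ ys w x∈ys
  ... | yes _    | there a∈w = reps-⊇ʳ ys w a∈w
  ... | no  _    | here refl = reps-⊇ˡ (ys ++ [ x ]) w (∈.∈-++⁺ʳ ys (here refl))
  ... | no  _    | there a∈w = reps-⊇ʳ (ys ++ [ x ]) w a∈w

  rank-repeat : ∀ ys {x} zs → x ∈ ys → ∀ a → rank (ys ++ x ∷ zs) a ≡ rank (ys ++ zs) a
  rank-repeat ys zs x∈ys a = ∑-cong (λ b → firstBefore-repeat ys zs a b x∈ys) (allFin k)

  rsQueries-rank : ∀ ys w → Unique ys →
    rsQueries sameLabel ys w + length (reps ys w) ≡ ∑ (rank (ys ++ w)) w + length w + length ys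
  rsQueries-rank ys []      _   = cong (_+ length ys) (sym (ℕ.+-identityʳ 0))
  rsQueries-rank ys (x ∷ w) ys! with x ∈? ys
  ... | yes x∈ys rewrite scan-present ys! x∈ys w = begin
      suc r + rsQueries sameLabel ys w + length (reps ys w)
    ≡⟨ ℕ.+-assoc (suc r) _ _ ⟩
      suc r + (rsQueries sameLabel ys w + length (reps ys w))
    ≡⟨ cong (suc r +_) (rsQueries-rank ys w ys!) ⟩
      suc r + (∑ (rank (ys ++ w)) w + length w + length ys)
    ≡⟨ regroup r (∑ (rank (ys ++ w)) w) (length w) (length ys) ⟩
      r + ∑ (rank (ys ++ w)) w + suc (length w) + length ys
    ≡⟨ cong₂ (λ r′ s → r′ + s + suc (length w) + length ys)
             (rank-repeat ys w x∈ys x) (∑-cong (rank-repeat ys w x∈ys) w) ⟨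
      rank (ys ++ x ∷ w) x + ∑ (rank (ys ++ x ∷ w)) w + suc (length w) + length ys
    ∎
    where
    open ≡-Reasoning
    r = rank (ys ++ w) x
    regroup : ∀ r s l d → suc r + (s + l + d) ≡ r + s + suc l + d
    regroup = solve-∀
  ... | no x∉ys rewrite scan-absent (All.¬Any⇒All¬ ys x∉ys) = begin
      length ys + rsQueries sameLabel ys′ w + length (reps ys′ w)
    ≡⟨ ℕ.+-assoc (length ys) _ _ ⟩
      length ys + (rsQueries sameLabel ys′ w + length (reps ys′ w))
    ≡⟨ cong (length ys +_) (rsQueries-rank ys′ w (unique-∷ʳ ys! x∉ys′)) ⟩
      length ys + (∑ (rank (ys′ ++ w)) w + length w + length ys′)
    ≡⟨ cong₂ (λ zs l → length ys + (∑ (rank zs) w + length w + l)) (List.++-assoc ys [ x ] w) (List.length-++ ys) ⟩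
      length ys + (∑ (rank (ys ++ x ∷ w)) w + length w + (length ys + 1))
    ≡⟨ regroup (length ys) (∑ (rank (ys ++ x ∷ w)) w) (length w) ⟩
      length ys + ∑ (rank (ys ++ x ∷ w)) w + suc (length w) + length ys
    ≡⟨ cong (λ r → r + ∑ (rank (ys ++ x ∷ w)) w + suc (length w) + length ys) (rank-absent w ys! x∉ys′) ⟨
      rank (ys ++ x ∷ w) x + ∑ (rank (ys ++ x ∷ w)) w + suc (length w) + length ys
    ∎
    where
    open ≡-Reasoning
    ys′ = ys ++ [ x ]
    x∉ys′ = All.¬Any⇒All¬ ys x∉ys
    regroup : ∀ d s l → d + (s + l + (d + 1)) ≡ d + s + suc l + d
    regroup = solve-∀

  rsKQueries≤rsQueries : ∀ ys w → Unique ys → length ys ≤ k → rsKQueries k sameLabel ys w ≤ rsQueries sameLabel ys w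
  rsKQueries≤rsQueries ys []      _   _      = z≤n
  rsKQueries≤rsQueries ys (x ∷ w) ys! |ys|≤k with length ys <ᵇ k in room
  ... | true
    with |ys|<k ← ℕ.<ᵇ⇒< (length ys) k (subst Bool.T (sym room) _)
    rewrite List.take-all (k ∸ 1) ys (<⇒≤∸1 |ys|<k)
    with x ∈? ys
  ...   | yes x∈ys rewrite scan-present ys! x∈ys w =
          ℕ.+-monoʳ-≤ (suc (rank (ys ++ w) x)) (rsKQueries≤rsQueries ys w ys! |ys|≤k)
  ...   | no  x∉ys rewrite scan-absent (All.¬Any⇒All¬ ys x∉ys) | room =
          ℕ.+-monoʳ-≤ (length ys) (rsKQueries≤rsQueries (ys ++ [ x ]) w (unique-∷ʳ ys! (All.¬Any⇒All¬ ys x∉ys))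
            (ℕ.≤-trans (ℕ.≤-reflexive (trans (List.length-++ ys) (ℕ.+-comm (length ys) 1))) |ys|<k))
  rsKQueries≤rsQueries ys (x ∷ w) ys! |ys|≤k | false
    with x∈ys ← unique-long-complete ys! (ℕ.≮⇒≥ (λ |ys|<k → subst Bool.T room (ℕ.<⇒<ᵇ |ys|<k))) x
    with q≤ ← subst (proj₁ (scan sameLabel x (take (k ∸ 1) ys)) ≤_) (cong proj₁ (scan-present ys! x∈ys w))
                    (scan-take-≤ sameLabel x (k ∸ 1) ys)
    rewrite scan-present ys! x∈ys w
    with scan sameLabel x (take (k ∸ 1) ys)
  ... | _ , true  = ℕ.+-mono-≤ q≤ (rsKQueries≤rsQueries ys w ys! |ys|≤k)
  ... | _ , false rewrite room = ℕ.+-mono-≤ q≤ (rsKQueries≤rsQueries ys w ys! |ys|≤k)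

private
  toℚᵘ-/ℕ : ∀ p q → toℚᵘ (p /ℕ suc q) ≃ mkℚᵘ (ℤ.+ p) q
  toℚᵘ-/ℕ p q = ℚ.toℚᵘ-fromℚᵘ (mkℚᵘ (ℤ.+ p) q)

  mkℚᵘ-+ : ∀ p r q → mkℚᵘ (ℤ.+ p) q ℚᵘ.+ mkℚᵘ (ℤ.+ r) q ≃ mkℚᵘ (ℤ.+ (p + r)) q
  mkℚᵘ-+ p r q = *≡* (trans (regroup (ℤ.+ p) (ℤ.+ r) (ℤ.+ d)) (cong₂ ℤ._*_ (ℤ.pos-+ p r) (ℤ.pos-* d d)))
    where
    d = suc q
    regroup : ∀ p r d → (p ℤ.* d ℤ.+ r ℤ.* d) ℤ.* d ≡ (p ℤ.+ r) ℤ.* (d ℤ.* d)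
    regroup = ℤ-solve-∀

/ℕ-cross : ∀ p q r s → 1 ≤ q → 1 ≤ s → p * s ≡ r * q → p /ℕ q ≡ r /ℕ s
/ℕ-cross p (suc q) r (suc s) _ _ ps≡rq = ℚ.fromℚᵘ-cong {mkℚᵘ (ℤ.+ p) q} {mkℚᵘ (ℤ.+ r) s}
  (*≡* (trans (sym (ℤ.pos-* p (suc s))) (trans (cong ℤ.+_ ps≡rq) (ℤ.pos-* r (suc q)))))

/ℕ-cross-≤ : ∀ p q r s → 1 ≤ q → 1 ≤ s → p * s ≤ r * q → p /ℕ q ≤ℚ r /ℕ s
/ℕ-cross-≤ p (suc q) r (suc s) _ _ ps≤rq = ℚ.toℚᵘ-cancel-≤
  (ℚᵘ.≤-respˡ-≃ (ℚᵘ.≃-sym (toℚᵘ-/ℕ p q)) (ℚᵘ.≤-respʳ-≃ (ℚᵘ.≃-sym (toℚᵘ-/ℕ r s))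
    (*≤* (subst₂ ℤ._≤_ (ℤ.pos-* p (suc s)) (ℤ.pos-* r (suc q)) (ℤ.+≤+ ps≤rq)))))

/ℕ-+ : ∀ p r q → 1 ≤ q → p /ℕ q +ℚ r /ℕ q ≡ (p + r) /ℕ q
/ℕ-+ p r (suc q) _ = ℚ.toℚᵘ-injective (begin
    toℚᵘ (p /ℕ suc q +ℚ r /ℕ suc q)            ≈⟨ ℚ.toℚᵘ-homo-+ (p /ℕ suc q) (r /ℕ suc q) ⟩
    toℚᵘ (p /ℕ suc q) ℚᵘ.+ toℚᵘ (r /ℕ suc q)   ≈⟨ ℚᵘ.+-cong (toℚᵘ-/ℕ p q) (toℚᵘ-/ℕ r q) ⟩
    mkℚᵘ (ℤ.+ p) q ℚᵘ.+ mkℚᵘ (ℤ.+ r) q         ≈⟨ mkℚᵘ-+ p r q ⟩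
    mkℚᵘ (ℤ.+ (p + r)) q                       ≈⟨ toℚᵘ-/ℕ (p + r) q ⟨
    toℚᵘ ((p + r) /ℕ suc q)                    ∎)
  where open ℚᵘ.≃-Reasoning

x+y≡z⇒x≡z-y : ∀ x y z → x +ℚ y ≡ z → x ≡ z - y
x+y≡z⇒x≡z-y x y z x+y≡z = begin
    x                    ≡⟨ ℚ.+-identityʳ x ⟨
    x +ℚ 0ℚ              ≡⟨ cong (x +ℚ_) (ℚ.+-inverseʳ y) ⟨
    x +ℚ (y +ℚ - y)      ≡⟨ ℚ.+-assoc x y (- y) ⟨
    (x +ℚ y) +ℚ - y      ≡⟨ cong (_- y) x+y≡z ⟩
    z - y                ∎
  where open ≡-Reasoning

4xy≤[x+y]² : ∀ x y → x * y * 4 ≤ (x + y) * (x + y)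
4xy≤[x+y]² x y with ℕ.≤-total x y
... | inj₁ x≤y rewrite sym (ℕ.m+[n∸m]≡n x≤y) =
  ℕ.≤-trans (ℕ.m≤m+n _ ((y ∸ x) * (y ∸ x))) (ℕ.≤-reflexive (square x (y ∸ x)))
  where
  square : ∀ x d → x * (x + d) * 4 + d * d ≡ (x + (x + d)) * (x + (x + d))
  square = solve-∀
... | inj₂ y≤x rewrite sym (ℕ.m+[n∸m]≡n y≤x) =
  ℕ.≤-trans (ℕ.m≤m+n _ ((x ∸ y) * (x ∸ y))) (ℕ.≤-reflexive (square y (x ∸ y)))
  where
  square : ∀ y d → (y + d) * y * 4 + d * d ≡ (y + d + y) * (y + d + y)
  square = solve-∀

sumℚ-++ : ∀ xs ys → sumℚ (xs ++ ys) ≡ sumℚ xs +ℚ sumℚ ys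
sumℚ-++ []       ys = sym (ℚ.+-identityˡ (sumℚ ys))
sumℚ-++ (x ∷ xs) ys = trans (cong (x +ℚ_) (sumℚ-++ xs ys)) (sym (ℚ.+-assoc x (sumℚ xs) (sumℚ ys)))

module _ {k : ℕ} where

  others : Fin k → List (Fin k) → List (Fin k)
  others a = filter (λ b → ¬? (a ≟ b))

  ∑-others : ∀ a (h : Fin k → ℕ) bs → ∑ h (others a bs) + occ a bs * h a ≡ ∑ h bs
  ∑-others a h []       = refl
  ∑-others a h (b ∷ bs) with a ≟ b
  ... | yes refl rewrite δ-refl a = trans (regroup (∑ h (others a bs)) (occ a bs) (h a)) (cong (h a +_) (∑-others a h bs))
    where
    regroup : ∀ s o x → s + (1 + o) * x ≡ x + (s + o * x)
    regroup = solve-∀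
  ... | no  a≢b  rewrite δ-≢ (a≢b ∘ sym) = trans (ℕ.+-assoc (h b) _ _) (cong (h b +_) (∑-others a h bs))

  sumDistinctPairs-/ℕ : ∀ (f : Fin k → Fin k → ℚ) (g : Fin k → Fin k → ℕ) d → 1 ≤ d →
    (∀ a b → a ≢ b → f a b ≡ g a b /ℕ d) →
    sumDistinctPairs k f ≡ ∑ (λ a → ∑ (g a) (others a (allFin k))) (allFin k) /ℕ d
  sumDistinctPairs-/ℕ f g d 1≤d f≡g/d = outer (allFin k)
    where
    zero/d : 0ℚ ≡ 0 /ℕ d
    zero/d = /ℕ-cross 0 1 0 d (s≤s z≤n) 1≤d refl
    inner : ∀ a bs → sumℚ (map (f a) (others a bs)) ≡ ∑ (g a) (others a bs) /ℕ d
    inner a []       = zero/d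
    inner a (b ∷ bs) with a ≟ b
    ... | yes _   = inner a bs
    ... | no  a≢b = trans (cong₂ _+ℚ_ (f≡g/d a b a≢b) (inner a bs)) (/ℕ-+ (g a b) _ d 1≤d)
    outer : ∀ as → sumℚ (concatMap (λ a → map (f a) (others a (allFin k))) as)
                   ≡ ∑ (λ a → ∑ (g a) (others a (allFin k))) as /ℕ d
    outer []       = zero/d
    outer (a ∷ as) = begin
        sumℚ (map (f a) (others a (allFin k)) ++ concatMap (λ a → map (f a) (others a (allFin k))) as)
      ≡⟨ sumℚ-++ (map (f a) (others a (allFin k))) _ ⟩
        sumℚ (map (f a) (others a (allFin k))) +ℚ sumℚ (concatMap (λ a → map (f a) (others a (allFin k))) as)
      ≡⟨ cong₂ _+ℚ_ (inner a (allFin k)) (outer as) ⟩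
        ∑ (g a) (others a (allFin k)) /ℕ d +ℚ ∑ (λ a → ∑ (g a) (others a (allFin k))) as /ℕ d
      ≡⟨ /ℕ-+ (∑ (g a) (others a (allFin k))) _ d 1≤d ⟩
        ∑ (λ a → ∑ (g a) (others a (allFin k))) (a ∷ as) /ℕ d
      ∎
      where open ≡-Reasoning

  sumDistinctPairs-mono : ∀ (f g : Fin k → Fin k → ℚ) → (∀ a b → f a b ≤ℚ g a b) →
    sumDistinctPairs k f ≤ℚ sumDistinctPairs k g
  sumDistinctPairs-mono f g f≤g = outer (allFin k)
    where
    inner : ∀ a bs → sumℚ (map (f a) bs) ≤ℚ sumℚ (map (g a) bs)
    inner a []       = ℚ.≤-refl
    inner a (b ∷ bs) = ℚ.+-mono-≤ (f≤g a b) (inner a bs)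
    outer : ∀ as → sumℚ (concatMap (λ a → map (f a) (others a (allFin k))) as)
                   ≤ℚ sumℚ (concatMap (λ a → map (g a) (others a (allFin k))) as)
    outer []       = ℚ.≤-refl
    outer (a ∷ as) =
      subst₂ _≤ℚ_ (sym (sumℚ-++ (map (f a) (others a (allFin k))) _)) (sym (sumℚ-++ (map (g a) (others a (allFin k))) _))
             (ℚ.+-mono-≤ (inner a (others a (allFin k))) (outer as))

-- The expected number of queries

module Clustering (n k : ℕ) (c : Fin n → Fin k) (c-onto : ∀ a → ∃ λ v → c v ≡ a)
                  (α : Fin n → Fin n → Bool) (α-correct : ∀ u v → ¬ u ≡ v → (α u v ≡ true ⇔ c u ≡ c v)) where

  orders : List (List (Fin n))
  orders = perms (allFin n)

  N : ℕ
  N = length orders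

  size : Fin k → ℕ
  size = clusterSize c

  N≡n! : N ≡ n !
  N≡n! = trans (length-perms (allFin n)) (cong _! (length-allFin n))

  1≤N : 1 ≤ N
  1≤N = subst (1 ≤_) (sym N≡n!) (ℕ.1≤n! n)

  α-sameLabel : ∀ u v → u ≢ v → α u v ≡ sameLabel (c u) (c v)
  α-sameLabel u v u≢v with c u ≟ c v
  ... | yes cu≡cv = Equivalence.from (α-correct u v u≢v) cu≡cv
  ... | no  cu≢cv with α u v in αuv
  ...   | true  = ⊥-elim (cu≢cv (Equivalence.to (α-correct u v u≢v) αuv))
  ...   | false = refl

  module _ {π : List (Fin n)} (π↭ : π ↭ allFin n) where

    order-unique : Unique π
    order-unique = PermutationSetoid.Unique-resp-↭ (setoid (Fin n)) (↭⇒↭ₛ (↭-sym π↭)) (Unique.allFin⁺ n)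

    labels-present : ∀ a → a ∈ map c π
    labels-present a with v , refl ← c-onto a = ∈.∈-map⁺ c (↭.∈-resp-↭ (↭-sym π↭) (∈.∈-allFin v))

    occ-labels : ∀ a → occ a (map c π) ≡ size a
    occ-labels a = begin
        occ a (map c π)                       ≡⟨ ∑-map (λ x → δ x a) c π ⟩
        ∑ (λ v → δ (c v) a) π                 ≡⟨ ∑-↭ (λ v → δ (c v) a) π↭ ⟩
        ∑ (λ v → δ (c v) a) (allFin n)        ≡⟨ length-filter-≟ c a (allFin n) ⟨
        size a                                ∎
      where open ≡-Reasoning

    queries-rank : rsQueries α [] π + k ≡ ∑ (λ a → size a * rank (map c π) a) (allFin k) + n
    queries-rank = begin
        rsQueries α [] π + k
      ≡⟨ cong₂ _+_ (rsQueries-map c α sameLabel α-sameLabel [] π order-unique (All.tabulate (λ _ → [])))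
                   (sym (unique-complete-length (reps-unique [] w []) (λ a → reps-⊇ʳ [] w (labels-present a)))) ⟩
        rsQueries sameLabel [] w + length (reps [] w)
      ≡⟨ rsQueries-rank [] w [] ⟩
        ∑ (rank w) w + length w + 0
      ≡⟨ ℕ.+-identityʳ _ ⟩
        ∑ (rank w) w + length w
      ≡⟨ cong₂ _+_ (trans (∑-byOcc (rank w) w) (∑-cong (λ a → cong (_* rank w a) (occ-labels a)) (allFin k)))
                   (trans (List.length-map c π) (trans (↭.↭-length π↭) (length-allFin n))) ⟩
        ∑ (λ a → size a * rank w a) (allFin k) + n
      ∎
      where
      open ≡-Reasoning
      w = map c π

  1≤size : ∀ a → 1 ≤ size a
  1≤size a = subst (1 ≤_) (occ-labels ↭-refl a) (occ-present (labels-present ↭-refl a))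

  ∑-size : ∑ size (allFin k) ≡ n
  ∑-size = begin
      ∑ size (allFin k)                              ≡⟨ ∑-cong (occ-labels ↭-refl) (allFin k) ⟨
      ∑ (λ a → occ a (map c (allFin n))) (allFin k)  ≡⟨ length-∑occ (map c (allFin n)) ⟨
      length (map c (allFin n))                      ≡⟨ trans (List.length-map c (allFin n)) (length-allFin n) ⟩
      n                                              ∎
    where open ≡-Reasoning

  k≤n : k ≤ n
  k≤n = begin
      k                          ≡⟨ trans (∑-length (allFin k)) (length-allFin k) ⟨
      ∑ (λ _ → 1) (allFin k)     ≤⟨ ∑-mono 1≤size (allFin k) ⟩
      ∑ size (allFin k)          ≡⟨ ∑-size ⟩
      n                          ∎
    where open ℕ.≤-Reasoning

  precedes : Fin k → Fin k → ℕ
  precedes b a = ∑ (λ π → firstBefore (map c π) b a) orders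

  precedes-self : ∀ a → precedes a a ≡ 0
  precedes-self a = trans (∑-cong (λ π → firstBefore-self (map c π) a) orders) (∑-zero orders)

  precedes-size : ∀ {a b} → a ≢ b → precedes b a * (size a + size b) ≡ N * size b
  precedes-size {a} {b} a≢b = begin
      precedes b a * (size a + size b)
    ≡⟨ cong₂ (λ p s → p * (s + size b)) (∑-cong (rivalLeads-map (role a b) c) orders) size-target ⟩
      ∑perms (rivalLeads κ) (allFin n) * (#target κ (allFin n) + size b)
    ≡⟨ cong (λ s → ∑perms (rivalLeads κ) (allFin n) * (#target κ (allFin n) + s)) size-rival ⟩
      ∑perms (rivalLeads κ) (allFin n) * (#target κ (allFin n) + #rival κ (allFin n))
    ≡⟨ ∑perms-rivalLeads κ n (allFin n) (length-allFin n) ⟩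
      n ! * #rival κ (allFin n)
    ≡⟨ cong₂ _*_ N≡n! size-rival ⟨
      N * size b
    ∎
    where
    open ≡-Reasoning
    κ : Fin n → Role
    κ = role a b ∘ c
    size-target : size a ≡ #target κ (allFin n)
    size-target = trans (length-filter-≟ c a (allFin n)) (sym (∑-cong (λ v → isTarget-role a b (c v)) (allFin n)))
    size-rival : size b ≡ #rival κ (allFin n)
    size-rival = trans (length-filter-≟ c b (allFin n)) (sym (∑-cong (isRival-role a≢b ∘ c) (allFin n)))

  weightedPrecedences : ℕ
  weightedPrecedences = ∑ (λ a → ∑ (λ b → size a * precedes b a) (others a (allFin k))) (allFin k)

  ∑-weightedRank : ∑ (λ π → ∑ (λ a → size a * rank (map c π) a) (allFin k)) orders ≡ weightedPrecedences
  ∑-weightedRank = begin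
      ∑ (λ π → ∑ (λ a → size a * rank (map c π) a) (allFin k)) orders
    ≡⟨ ∑-comm (λ π a → size a * rank (map c π) a) orders (allFin k) ⟩
      ∑ (λ a → ∑ (λ π → size a * rank (map c π) a) orders) (allFin k)
    ≡⟨ ∑-cong (λ a → trans (∑-*ˡ (size a) (λ π → rank (map c π) a) orders)
                            (cong (size a *_) (∑-comm (λ π b → firstBefore (map c π) b a) orders (allFin k)))) (allFin k) ⟩
      ∑ (λ a → size a * ∑ (λ b → precedes b a) (allFin k)) (allFin k)
    ≡⟨ ∑-cong (λ a → cong (size a *_) (sym (drop-self a))) (allFin k) ⟩
      ∑ (λ a → size a * ∑ (λ b → precedes b a) (others a (allFin k))) (allFin k)
    ≡⟨ ∑-cong (λ a → ∑-*ˡ (size a) (λ b → precedes b a) (others a (allFin k))) (allFin k) ⟨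
      weightedPrecedences
    ∎
    where
    open ≡-Reasoning
    drop-self : ∀ a → ∑ (λ b → precedes b a) (others a (allFin k)) ≡ ∑ (λ b → precedes b a) (allFin k)
    drop-self a = begin
        ∑ (λ b → precedes b a) (others a (allFin k))
      ≡⟨ ℕ.+-identityʳ _ ⟨
        ∑ (λ b → precedes b a) (others a (allFin k)) + 0
      ≡⟨ cong (∑ (λ b → precedes b a) (others a (allFin k)) +_)
              (trans (cong (occ a (allFin k) *_) (precedes-self a)) (ℕ.*-zeroʳ (occ a (allFin k)))) ⟨
        ∑ (λ b → precedes b a) (others a (allFin k)) + occ a (allFin k) * precedes a a
      ≡⟨ ∑-others a (λ b → precedes b a) (allFin k) ⟩
        ∑ (λ b → precedes b a) (allFin k)
      ∎

  ∑-queries : ∑ (rsQueries α []) orders ≡ N * (n ∸ k) + weightedPrecedences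
  ∑-queries = ℕ.+-cancelʳ-≡ (N * k) _ _ (begin
      ∑ (rsQueries α []) orders + N * k
    ≡⟨ cong (∑ (rsQueries α []) orders +_) (∑-const k orders) ⟨
      ∑ (rsQueries α []) orders + ∑ (λ _ → k) orders
    ≡⟨ ∑-+ (rsQueries α []) (λ _ → k) orders ⟨
      ∑ (λ π → rsQueries α [] π + k) orders
    ≡⟨ ∑-cong-on (All.map queries-rank (perms-↭ (allFin n))) ⟩
      ∑ (λ π → ∑ (λ a → size a * rank (map c π) a) (allFin k) + n) orders
    ≡⟨ ∑-+ _ (λ _ → n) orders ⟩
      ∑ (λ π → ∑ (λ a → size a * rank (map c π) a) (allFin k)) orders + ∑ (λ _ → n) orders
    ≡⟨ cong₂ _+_ ∑-weightedRank (∑-const n orders) ⟩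
      weightedPrecedences + N * n
    ≡⟨ cong (λ m → weightedPrecedences + N * m) (ℕ.m∸n+n≡m k≤n) ⟨
      weightedPrecedences + N * (n ∸ k + k)
    ≡⟨ regroup weightedPrecedences N (n ∸ k) k ⟩
      N * (n ∸ k) + weightedPrecedences + N * k
    ∎)
    where
    open ≡-Reasoning
    regroup : ∀ x N d k → x + N * (d + k) ≡ N * d + x + N * k
    regroup = solve-∀

  expectation : EQ n α (allFin n)
    ≡ (n ∸ k) /ℕ 1 +ℚ sumDistinctPairs k (λ a b → (size a * size b) /ℕ (size a + size b))
  expectation = begin
      ∑ (rsQueries α []) orders /ℕ N
    ≡⟨ cong (_/ℕ N) ∑-queries ⟩
      (N * (n ∸ k) + weightedPrecedences) /ℕ N
    ≡⟨ /ℕ-+ (N * (n ∸ k)) weightedPrecedences N 1≤N ⟨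
      (N * (n ∸ k)) /ℕ N +ℚ weightedPrecedences /ℕ N
    ≡⟨ cong₂ _+ℚ_ (/ℕ-cross (N * (n ∸ k)) N (n ∸ k) 1 1≤N (s≤s z≤n) (trans (ℕ.*-identityʳ _) (ℕ.*-comm N (n ∸ k))))
                  (sym (sumDistinctPairs-/ℕ _ (λ a b → size a * precedes b a) N 1≤N pair)) ⟩
      (n ∸ k) /ℕ 1 +ℚ sumDistinctPairs k (λ a b → (size a * size b) /ℕ (size a + size b))
    ∎
    where
    open ≡-Reasoning
    pair : ∀ a b → a ≢ b → (size a * size b) /ℕ (size a + size b) ≡ (size a * precedes b a) /ℕ N
    pair a b a≢b = /ℕ-cross (size a * size b) (size a + size b) (size a * precedes b a) N
      (ℕ.≤-trans (1≤size a) (ℕ.m≤m+n _ _)) 1≤N (begin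
        size a * size b * N                           ≡⟨ regroup (size a) (size b) N ⟩
        size a * (N * size b)                         ≡⟨ cong (size a *_) (precedes-size a≢b) ⟨
        size a * (precedes b a * (size a + size b))   ≡⟨ ℕ.*-assoc (size a) _ _ ⟨
        size a * precedes b a * (size a + size b)     ∎)
      where
      regroup : ∀ x y N → x * y * N ≡ x * (N * y)
      regroup = solve-∀

  EQk≤EQ : EQk n k α (allFin n) ≤ℚ EQ n α (allFin n)
  EQk≤EQ = /ℕ-cross-≤ _ N _ N 1≤N 1≤N (ℕ.*-monoˡ-≤ N (∑-mono-on (All.map pointwise (perms-↭ (allFin n)))))
    where
    pointwise : ∀ {π} → π ↭ allFin n → rsKQueries k α [] π ≤ rsQueries α [] π
    pointwise {π} π↭ = subst₂ _≤_
      (sym (rsKQueries-map c α sameLabel α-sameLabel k [] π (order-unique π↭) (All.tabulate (λ _ → []))))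
      (sym (rsQueries-map c α sameLabel α-sameLabel [] π (order-unique π↭) (All.tabulate (λ _ → []))))
      (rsKQueries≤rsQueries [] (map c π) [] z≤n)

  pairSizes : ℕ
  pairSizes = ∑ (λ a → ∑ (λ b → size a + size b) (others a (allFin k))) (allFin k)

  pairSizes+2n : pairSizes + (n + n) ≡ k * n + k * n
  pairSizes+2n = begin
      pairSizes + (n + n)
    ≡⟨ cong (pairSizes +_) (trans (∑-+ size size (allFin k)) (cong₂ _+_ ∑-size ∑-size)) ⟨
      pairSizes + ∑ (λ a → size a + size a) (allFin k)
    ≡⟨ ∑-+ _ (λ a → size a + size a) (allFin k) ⟨
      ∑ (λ a → ∑ (λ b → size a + size b) (others a (allFin k)) + (size a + size a)) (allFin k)
    ≡⟨ ∑-cong (λ a → trans (cong (∑ (λ b → size a + size b) (others a (allFin k)) +_)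
                              (sym (trans (cong (_* (size a + size a)) (occ-allFin a)) (ℕ.*-identityˡ _))))
                           (∑-others a (λ b → size a + size b) (allFin k))) (allFin k) ⟩
      ∑ (λ a → ∑ (λ b → size a + size b) (allFin k)) (allFin k)
    ≡⟨ ∑-cong (λ a → trans (∑-+ (λ _ → size a) size (allFin k))
                           (cong₂ _+_ (∑-const-allFin (size a)) ∑-size)) (allFin k) ⟩
      ∑ (λ a → k * size a + n) (allFin k)
    ≡⟨ ∑-+ (λ a → k * size a) (λ _ → n) (allFin k) ⟩
      ∑ (λ a → k * size a) (allFin k) + ∑ (λ _ → n) (allFin k)
    ≡⟨ cong₂ _+_ (trans (∑-*ˡ k size (allFin k)) (cong (k *_) ∑-size)) (∑-const-allFin n) ⟩
      k * n + k * n
    ∎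
    where
    open ≡-Reasoning
    ∑-const-allFin : ∀ m → ∑ (λ _ → m) (allFin k) ≡ k * m
    ∑-const-allFin m = trans (∑-const m (allFin k)) (cong (_* m) (length-allFin k))

  bound≡closedForm : (n ∸ k) /ℕ 1 +ℚ pairSizes /ℕ 4 ≡ (n * (k + 1)) /ℕ 2 - k /ℕ 1
  bound≡closedForm = x+y≡z⇒x≡z-y _ (k /ℕ 1) _ (begin
      ((n ∸ k) /ℕ 1 +ℚ pairSizes /ℕ 4) +ℚ k /ℕ 1
    ≡⟨ cong₂ (λ p q → (p +ℚ pairSizes /ℕ 4) +ℚ q) (over4 (n ∸ k)) (over4 k) ⟩
      ((4 * (n ∸ k)) /ℕ 4 +ℚ pairSizes /ℕ 4) +ℚ (4 * k) /ℕ 4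
    ≡⟨ cong (_+ℚ (4 * k) /ℕ 4) (/ℕ-+ (4 * (n ∸ k)) pairSizes 4 (s≤s z≤n)) ⟩
      (4 * (n ∸ k) + pairSizes) /ℕ 4 +ℚ (4 * k) /ℕ 4
    ≡⟨ /ℕ-+ (4 * (n ∸ k) + pairSizes) (4 * k) 4 (s≤s z≤n) ⟩
      (4 * (n ∸ k) + pairSizes + 4 * k) /ℕ 4
    ≡⟨ /ℕ-cross (4 * (n ∸ k) + pairSizes + 4 * k) 4 (n * (k + 1)) 2 (s≤s z≤n) (s≤s z≤n) cross ⟩
      (n * (k + 1)) /ℕ 2
    ∎)
    where
    open ≡-Reasoning
    over4 : ∀ x → x /ℕ 1 ≡ (4 * x) /ℕ 4
    over4 x = /ℕ-cross x 1 (4 * x) 4 (s≤s z≤n) (s≤s z≤n) (trans (ℕ.*-comm x 4) (sym (ℕ.*-identityʳ (4 * x))))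
    arithmetic : ∀ d k y → y + ((d + k) + (d + k)) ≡ k * (d + k) + k * (d + k) → (4 * d + y + 4 * k) * 2 ≡ (d + k) * (k + 1) * 4
    arithmetic d k y y+2n≡2kn = begin
        (4 * d + y + 4 * k) * 2                          ≡⟨ expand d k y ⟩
        2 * (y + ((d + k) + (d + k))) + 4 * (d + k)      ≡⟨ cong (λ t → 2 * t + 4 * (d + k)) y+2n≡2kn ⟩
        2 * (k * (d + k) + k * (d + k)) + 4 * (d + k)    ≡⟨ collect d k ⟩
        (d + k) * (k + 1) * 4                            ∎
      where
      expand : ∀ d k y → (4 * d + y + 4 * k) * 2 ≡ 2 * (y + ((d + k) + (d + k))) + 4 * (d + k)
      expand = solve-∀
      collect : ∀ d k → 2 * (k * (d + k) + k * (d + k)) + 4 * (d + k) ≡ (d + k) * (k + 1) * 4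
      collect = solve-∀
    n≡d+k : n ≡ n ∸ k + k
    n≡d+k = sym (ℕ.m∸n+n≡m k≤n)
    cross : (4 * (n ∸ k) + pairSizes + 4 * k) * 2 ≡ n * (k + 1) * 4
    cross = subst (λ m → (4 * (n ∸ k) + pairSizes + 4 * k) * 2 ≡ m * (k + 1) * 4) (sym n≡d+k)
      (arithmetic (n ∸ k) k pairSizes (subst (λ m → pairSizes + (m + m) ≡ k * m + k * m) n≡d+k pairSizes+2n))

  EQ≤bound : EQ n α (allFin n) ≤ℚ (n * (k + 1)) /ℕ 2 - k /ℕ 1
  EQ≤bound = begin
      EQ n α (allFin n)
    ≡⟨ expectation ⟩
      (n ∸ k) /ℕ 1 +ℚ sumDistinctPairs k (λ a b → (size a * size b) /ℕ (size a + size b))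
    ≤⟨ ℚ.+-monoʳ-≤ ((n ∸ k) /ℕ 1) (sumDistinctPairs-mono _ _ pair≤) ⟩
      (n ∸ k) /ℕ 1 +ℚ sumDistinctPairs k (λ a b → (size a + size b) /ℕ 4)
    ≡⟨ cong ((n ∸ k) /ℕ 1 +ℚ_) (sumDistinctPairs-/ℕ _ (λ a b → size a + size b) 4 (s≤s z≤n) (λ _ _ _ → refl)) ⟩
      (n ∸ k) /ℕ 1 +ℚ pairSizes /ℕ 4
    ≡⟨ bound≡closedForm ⟩
      (n * (k + 1)) /ℕ 2 - k /ℕ 1
    ∎
    where
    open ℚ.≤-Reasoning
    pair≤ : ∀ a b → (size a * size b) /ℕ (size a + size b) ≤ℚ (size a + size b) /ℕ 4
    pair≤ a b = /ℕ-cross-≤ (size a * size b) (size a + size b) (size a + size b) 4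
      (ℕ.≤-trans (1≤size a) (ℕ.m≤m+n _ _)) (s≤s z≤n) (4xy≤[x+y]² (size a) (size b))

lemma5 : (n k : ℕ) (c : Fin n → Fin k) → (∀ a → ∃ λ v → c v ≡ a)
    → (α : Fin n → Fin n → Bool)
    → (∀ u v → ¬ u ≡ v → (α u v ≡ true ⇔ c u ≡ c v))
    → (EQ n α (allFin n)
         ≡ (n ∸ k) /ℕ 1
           +ℚ sumDistinctPairs k (λ a b → (clusterSize c a * clusterSize c b) /ℕ (clusterSize c a + clusterSize c b)))
      × (EQk n k α (allFin n) ≤ℚ EQ n α (allFin n))
      × (EQ n α (allFin n) ≤ℚ (n * (k + 1)) /ℕ 2 - k /ℕ 1)
lemma5 n k c c-onto α α-correct = expectation , EQk≤EQ , EQ≤bound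
  where open Clustering n k c c-onto α α-correct
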